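{- Let $\mathcal F\subseteq\mathcal P([n])$ be $\mathcal N$-saturated and let $\mathcal G$ be a component of $\mathcal F$. If $T$ is a maximal element of $\mathcal G$ and $S$ is a minimal element of $\mathcal G$ (with respect to inclusion), then $S\subseteq T$.
   Context: $[n]=\{1,\dots,n\}$, $\mathcal P([n])$ its power set ordered by inclusion. The poset $\mathcal N$ has four elements $a,b,c,d$ with $a<c$, $b<c$, $b<d$ and no other comparabilities. A family $\mathcal F$ contains an induced copy of $\mathcal N$ if there are distinct $P,Q,R,S\in\mathcal F$ with $P\subset R$, $Q\subset R$, $Q\subset S$ and each of the pairs $\{P,Q\},\{P,S\},\{R,S\}$ incomparable. $\mathcal F$ is $\mathcal N$-saturated if it contains no induced copy of $\mathcal N$ but $\mathcal F\cup\{X\}$ contains one for every $X\in\mathcal P([n])\setminus\mathcal F$. A component of $\mathcal F$ is the vertex set of a connected component of the Hasse diagram of $(\mathcal F\setminus\{\emptyset,[n]\},\subseteq)$ viewed as an undirected graph; its minimal and maximal elements are taken with respect to inclusion within the component. -}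

module Defs where

open import Data.Nat using (ℕ)
open import Data.Fin.Subset using (Subset; _⊆_) renaming (⊥ to ∅; ⊤ to full)
open import Data.Product using (_×_; ∃-syntax)
open import Data.Sum using (_⊎_)
open import Relation.Nullary using (¬_)
open import Relation.Binary.PropositionalEquality using (_≡_; _≢_)
open import Relation.Binary.Construct.Closure.ReflexiveTransitive using (Star)

Family : ℕ → Set₁
Family n = Subset n → Set

_⊂_ : ∀ {n} → Subset n → Subset n → Set
A ⊂ B = A ⊆ B × A ≢ B

Incomparable : ∀ {n} → Subset n → Subset n → Set
Incomparable A B = ¬ (A ⊆ B) × ¬ (B ⊆ A)

-- F contains an induced copy of the poset N (a<c, b<c, b<d)
ContainsN : ∀ {n} → Family n → Set
ContainsN {n} F =
  ∃[ P ] ∃[ Q ] ∃[ R ] ∃[ S ]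
    (F P × F Q × F R × F S
    × P ≢ Q × P ≢ R × P ≢ S × Q ≢ R × Q ≢ S × R ≢ S
    × P ⊂ R × Q ⊂ R × Q ⊂ S
    × Incomparable P Q × Incomparable P S × Incomparable R S)

insert : ∀ {n} → Family n → Subset n → Family n
insert F X Y = F Y ⊎ Y ≡ X

NSaturated : ∀ {n} → Family n → Set
NSaturated {n} F =
  ¬ ContainsN F × (∀ (X : Subset n) → ¬ F X → ContainsN (insert F X))

Inner : ∀ {n} → Family n → Family n
Inner F A = F A × A ≢ ∅ × A ≢ full

Covers : ∀ {n} → Family n → Subset n → Subset n → Set
Covers F A B =
  Inner F A × Inner F B × A ⊂ B × (∀ C → Inner F C → A ⊂ C → ¬ (C ⊂ B))

HasseEdge : ∀ {n} → Family n → Subset n → Subset n → Set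
HasseEdge F A B = Covers F A B ⊎ Covers F B A

SameComponent : ∀ {n} → Family n → Subset n → Subset n → Set
SameComponent F = Star (HasseEdge F)

MaximalInComponent : ∀ {n} → Family n → Subset n → Set
MaximalInComponent F T =
  Inner F T × (∀ U → SameComponent F T U → ¬ (T ⊂ U))

MinimalInComponent : ∀ {n} → Family n → Subset n → Set
MinimalInComponent F S =
  Inner F S × (∀ U → SameComponent F S U → ¬ (U ⊂ S))

{-# OPTIONS --safe #-}
module Submission where

-- Walk along a Hasse path from S to T, keeping the invariant that every maximal
-- element of the component containing the current vertex Y also contains S.
-- Steps up preserve it trivially.  On a step down from Y to Y' ⊆ Y, suppose a
-- maximal M ⊇ Y' misses S; choosing a maximal M₀ ⊇ Y (by finiteness) gives
-- S ⊆ M₀, and then S, Y', M₀, M form an induced N with S, Y' < M₀ and Y' < M,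
-- where minimality of S and maximality of M supply the incomparabilities.
-- At the end Y = T, and T itself is a maximal element containing T.

open import Defs
open import Data.Nat using (ℕ)
open import Data.Bool using (_≟_)
open import Data.Fin.Subset using (Subset; _⊆_; inside; outside) renaming (_⊂_ to _⊂ₛ_; _⊃_ to _⊃ₛ_)
open import Data.Fin.Subset.Properties using (_⊆?_; ⊆-refl; ⊆-trans; ⊆-reflexive; drop-∷-⊆; s⊂s; out⊂in)
open import Data.Fin.Subset.Induction using (⊃-wellFounded)
open import Data.Vec using ([]; _∷_; here)
open import Data.Vec.Properties using (≡-dec)
open import Data.Product using (_×_; _,_; proj₁; proj₂; ∃-syntax)
open import Data.Sum using (inj₁; inj₂; swap)
open import Induction.WellFounded using (Acc; acc)
open import Relation.Nullary using (¬_; contradiction)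
open import Relation.Nullary.Decidable using (decidable-stable)
open import Relation.Binary.PropositionalEquality using (_≡_; _≢_; refl; sym; cong; subst)
open import Relation.Binary.Construct.Closure.ReflexiveTransitive using (ε; _◅_; _◅◅_; reverse)

⊆∧≢⇒⊂ : ∀ {n} {p q : Subset n} → p ⊆ q → p ≢ q → p ⊂ₛ q
⊆∧≢⇒⊂ {p = []}          {[]}          _   p≢q = contradiction refl p≢q
⊆∧≢⇒⊂ {p = inside ∷ p}  {outside ∷ q} p⊆q _   = contradiction (p⊆q here) λ ()
⊆∧≢⇒⊂ {p = outside ∷ p} {inside ∷ q}  p⊆q _   = out⊂in (drop-∷-⊆ p⊆q)
⊆∧≢⇒⊂ {p = inside ∷ p}  {inside ∷ q}  p⊆q p≢q =
  s⊂s (⊆∧≢⇒⊂ (drop-∷-⊆ p⊆q) (λ p≡q → p≢q (cong (inside ∷_) p≡q)))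
⊆∧≢⇒⊂ {p = outside ∷ p} {outside ∷ q} p⊆q p≢q =
  s⊂s (⊆∧≢⇒⊂ (drop-∷-⊆ p⊆q) (λ p≡q → p≢q (cong (outside ∷_) p≡q)))

⊆∧⊄⇒≡ : ∀ {n} {p q : Subset n} → p ⊆ q → ¬ (p ⊂ q) → p ≡ q
⊆∧⊄⇒≡ {p = p} {q} p⊆q p⊄q = decidable-stable (≡-dec _≟_ p q) λ p≢q → p⊄q (p⊆q , p≢q)

inducedN : ∀ {n} {F : Family n} {P Q R S : Subset n} →
  F P → F Q → F R → F S → P ⊆ R → Q ⊆ R → Q ⊆ S →
  Incomparable P Q → Incomparable P S → Incomparable R S → ContainsN F
inducedN {P = P} {Q} {R} {S} FP FQ FR FS P⊆R Q⊆R Q⊆S P∥Q P∥S R∥S =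
  P , Q , R , S , FP , FQ , FR , FS ,
  P≢Q , P≢R , P≢S , Q≢R , Q≢S , R≢S ,
  (P⊆R , P≢R) , (Q⊆R , Q≢R) , (Q⊆S , Q≢S) , P∥Q , P∥S , R∥S
  where
  P≢Q : P ≢ Q
  P≢Q P≡Q = proj₁ P∥Q (⊆-reflexive P≡Q)
  P≢R : P ≢ R
  P≢R P≡R = proj₂ P∥Q (subst (Q ⊆_) (sym P≡R) Q⊆R)
  P≢S : P ≢ S
  P≢S P≡S = proj₁ P∥S (⊆-reflexive P≡S)
  Q≢R : Q ≢ R
  Q≢R Q≡R = proj₁ P∥Q (subst (P ⊆_) (sym Q≡R) P⊆R)
  Q≢S : Q ≢ S
  Q≢S Q≡S = proj₂ R∥S (subst (_⊆ R) Q≡S Q⊆R)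
  R≢S : R ≢ S
  R≢S R≡S = proj₁ R∥S (⊆-reflexive R≡S)

covers⇒⊆ : ∀ {n} {F : Family n} {A B : Subset n} → Covers F A B → A ⊆ B
covers⇒⊆ (_ , _ , (A⊆B , _) , _) = A⊆B

module _ {n : ℕ} (F : Family n) where

  component-sym : ∀ {A B} → SameComponent F A B → SameComponent F B A
  component-sym = reverse swap

  inner-along-component : ∀ {A B} → Inner F A → SameComponent F A B → Inner F B
  inner-along-component innerA ε                = innerA
  inner-along-component _      (inj₁ A⋖C ◅ C~B) = inner-along-component (proj₁ (proj₂ A⋖C)) C~B
  inner-along-component _      (inj₂ C⋖A ◅ C~B) = inner-along-component (proj₁ C⋖A) C~B

  maximal-⊆⇒≡ : ∀ {M U} → MaximalInComponent F M → SameComponent F M U → M ⊆ U → M ≡ U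
  maximal-⊆⇒≡ (_ , maximal) M~U M⊆U = ⊆∧⊄⇒≡ M⊆U (maximal _ M~U)

  minimal-⊆⇒≡ : ∀ {S U} → MinimalInComponent F S → SameComponent F S U → U ⊆ S → U ≡ S
  minimal-⊆⇒≡ (_ , minimal) S~U U⊆S = ⊆∧⊄⇒≡ U⊆S (minimal _ S~U)

  ¬¬maximal-above : ∀ {Y} → Inner F Y →
    ¬ ¬ (∃[ M ] (SameComponent F Y M × MaximalInComponent F M × Y ⊆ M))
  ¬¬maximal-above {Y} = go (⊃-wellFounded Y)
    where
    go : ∀ {Y} → Acc _⊃ₛ_ Y → Inner F Y →
      ¬ ¬ (∃[ M ] (SameComponent F Y M × MaximalInComponent F M × Y ⊆ M))
    go {Y} (acc above) innerY none = none (Y , ε , (innerY , Y-maximal) , ⊆-refl)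
      where
      Y-maximal : ∀ U → SameComponent F Y U → ¬ (Y ⊂ U)
      Y-maximal U Y~U (Y⊆U , Y≢U) =
        go (above (⊆∧≢⇒⊂ Y⊆U Y≢U)) (inner-along-component innerY Y~U)
          λ (M , U~M , maxM , U⊆M) → none (M , Y~U ◅◅ U~M , maxM , ⊆-trans Y⊆U U⊆M)

  BelowMaximalsAbove : Subset n → Subset n → Set
  BelowMaximalsAbove S Y =
    ∀ M → MaximalInComponent F M → SameComponent F S M → Y ⊆ M → S ⊆ M

  below-maximals-above-up : ∀ {S Y Y'} → Y ⊆ Y' →
    BelowMaximalsAbove S Y → BelowMaximalsAbove S Y'
  below-maximals-above-up Y⊆Y' S≼Y M maxM S~M Y'⊆M = S≼Y M maxM S~M (⊆-trans Y⊆Y' Y'⊆M)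

  below-maximals-above-down : ¬ ContainsN F → ∀ {S Y Y'} → MinimalInComponent F S →
    SameComponent F S Y → SameComponent F S Y' → Y' ⊆ Y →
    BelowMaximalsAbove S Y → BelowMaximalsAbove S Y'
  below-maximals-above-down N-free {S} {Y} {Y'} minS S~Y S~Y' Y'⊆Y S≼Y M maxM S~M Y'⊆M =
    decidable-stable (S ⊆? M) λ S⊈M →
      ¬¬maximal-above (inner-along-component (proj₁ minS) S~Y)
        λ (M₀ , Y~M₀ , maxM₀ , Y⊆M₀) → N-free (N-copy S⊈M M₀ (S~Y ◅◅ Y~M₀) maxM₀ Y⊆M₀)
    where
    N-copy : ¬ (S ⊆ M) → ∀ M₀ → SameComponent F S M₀ → MaximalInComponent F M₀ → Y ⊆ M₀ →
      ContainsN F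
    N-copy S⊈M M₀ S~M₀ maxM₀ Y⊆M₀ =
      inducedN (proj₁ (proj₁ minS)) (proj₁ (inner-along-component (proj₁ minS) S~Y'))
        (proj₁ (proj₁ maxM₀)) (proj₁ (proj₁ maxM))
        S⊆M₀ (⊆-trans Y'⊆Y Y⊆M₀) Y'⊆M
        ((λ S⊆Y' → S⊈M (⊆-trans S⊆Y' Y'⊆M)) , Y'⊈S)
        (S⊈M , λ M⊆S → Y'⊈S (⊆-trans Y'⊆M M⊆S))
        ((λ M₀⊆M → S⊈M (⊆-trans S⊆M₀ M₀⊆M)) , M⊈M₀)
      where
      S⊆M₀ : S ⊆ M₀
      S⊆M₀ = S≼Y M₀ maxM₀ S~M₀ Y⊆M₀
      Y'⊈S : ¬ (Y' ⊆ S)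
      Y'⊈S Y'⊆S = S⊈M (subst (_⊆ M) (minimal-⊆⇒≡ minS S~Y' Y'⊆S) Y'⊆M)
      M⊈M₀ : ¬ (M ⊆ M₀)
      M⊈M₀ M⊆M₀ = S⊈M (subst (S ⊆_) (sym M≡M₀) S⊆M₀)
        where M≡M₀ = maximal-⊆⇒≡ maxM (component-sym S~M ◅◅ S~M₀) M⊆M₀

  below-maximals-above-along : ¬ ContainsN F → ∀ {S Y Z} → MinimalInComponent F S →
    SameComponent F S Y → BelowMaximalsAbove S Y → SameComponent F Y Z →
    BelowMaximalsAbove S Z
  below-maximals-above-along _ _ _ S≼Y ε = S≼Y
  below-maximals-above-along N-free minS S~Y S≼Y (inj₁ Y⋖Y' ◅ Y'~Z) =
    below-maximals-above-along N-free minS (S~Y ◅◅ inj₁ Y⋖Y' ◅ ε)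
      (below-maximals-above-up (covers⇒⊆ Y⋖Y') S≼Y) Y'~Z
  below-maximals-above-along N-free minS S~Y S≼Y (inj₂ Y'⋖Y ◅ Y'~Z) =
    below-maximals-above-along N-free minS S~Y'
      (below-maximals-above-down N-free minS S~Y S~Y' (covers⇒⊆ Y'⋖Y) S≼Y) Y'~Z
    where
    S~Y' = S~Y ◅◅ inj₂ Y'⋖Y ◅ ε

lemma2p1 : (n : ℕ) (F : Family n) → NSaturated F →
    (S T : Subset n) → SameComponent F S T →
    MaximalInComponent F T → MinimalInComponent F S →
    S ⊆ T
lemma2p1 n F (N-free , _) S T S~T maxT minS =
  below-maximals-above-along F N-free minS ε (λ _ _ _ S⊆M → S⊆M) S~T T maxT S~T ⊆-refl
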